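{- If $H$ is a hypergraph with maximum hyperedge cardinality $\overline{\Delta}$ and no isolated vertices, then $b_L(H)\le |V(H)|-\left\lceil \frac{|V(H)|}{\overline{\Delta}}\right\rceil$.
   Context: A hypergraph $H$ consists of a finite vertex set $V(H)$ and a finite collection $E(H)$ of subsets of $V(H)$. An isolated vertex is one contained in no hyperedge. Lazy burning: a set $B\subseteq V(H)$ is burned initially; in each subsequent round every unburned vertex $v$ for which some hyperedge $h\ni v$ has $h\setminus\{v\}$ entirely burned becomes burned. $B$ is a lazy burning set if eventually all vertices burn; $b_L(H)$ is the minimum size of a lazy burning set. -}

module Defs where

open import Data.Nat using (ℕ; zero; suc; _+_; _∸_; _⊔_; NonZero)
open import Data.Nat.DivMod using (_/_)
open import Data.Fin using (Fin)
open import Data.Fin.Subset using (Subset; _∈_; ∣_∣)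
open import Data.List using (List; []; _∷_)
open import Data.List.Membership.Propositional renaming (_∈_ to _∈ᴸ_)
open import Data.Product using (Σ; ∃; _×_)
open import Data.Sum using (_⊎_)
open import Relation.Binary.PropositionalEquality using (_≢_)

record Hypergraph : Set where
  constructor hypergraph
  field
    n     : ℕ
    edges : List (Subset n)
open Hypergraph public

maxEdgeSize : ∀ {n} → List (Subset n) → ℕ
maxEdgeSize []       = 0
maxEdgeSize (h ∷ hs) = ∣ h ∣ ⊔ maxEdgeSize hs

NoIsolated : Hypergraph → Set
NoIsolated H = (v : Fin (n H)) → Σ (Subset (n H)) λ h → (h ∈ᴸ edges H) × (v ∈ h)

-- Lazy burning process: Burned H B t v means v is burned after round t,
-- starting from the initial set B burned at round 0.
data Burned (H : Hypergraph) (B : Subset (n H)) : ℕ → Fin (n H) → Set where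
  initial : ∀ {v} → v ∈ B → Burned H B zero v
  stay    : ∀ {t v} → Burned H B t v → Burned H B (suc t) v
  spread  : ∀ {t v} (h : Subset (n H)) → h ∈ᴸ edges H → v ∈ h →
            (∀ u → u ∈ h → u ≢ v → Burned H B t u) →
            Burned H B (suc t) v

IsLazyBurningSet : (H : Hypergraph) → Subset (n H) → Set
IsLazyBurningSet H B = ∃ λ t → ∀ v → Burned H B t v

⌈_/_⌉ : (m d : ℕ) → .{{NonZero d}} → ℕ
⌈ m / d ⌉ = (m + d ∸ 1) / d

-- Greedily pick a vertex v not yet covered, cover it by a hyperedge h ∋ v, and
-- leave v unburned.  If t vertices get picked, their t hyperedges cover V(H),
-- so t ≥ ⌈|V(H)| / Δ̄⌉, and the other |V(H)| − t vertices form a lazy burning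
-- set: the i-th picked vertex burns by round i through its hyperedge, whose
-- other vertices are never picked later.
module Submission where

open import Defs
open import Data.Nat using (ℕ; zero; suc; _+_; _*_; _∸_; _≤_; _<_; NonZero; z≤n; s≤s)
open import Data.Nat.Properties
open import Data.Nat.DivMod using (m<n*o⇒m/o<n)
open import Data.Fin using (Fin) renaming (_≟_ to _≟ᶠ_)
open import Data.Fin.Subset using (Subset; ∣_∣; _∈_; _∉_; _─_; _-_; _⊆_; ⊤; Empty; inside; outside)
open import Data.Fin.Subset.Properties
  using (nonempty?; _∈?_; Empty-unique; ∣⊥∣≡0; ∣⊤∣≡n; ∈⊤; p─q⊆p; x∈p∧x∉q⇒x∈p─q;
         x∈p∧x≢y⇒x∈p-y; x∈p⇒∣p-x∣<∣p∣; x∈p∩q⁺; p∩q≢∅⇒∣p─q∣<∣p∣)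
open import Data.Vec using ([]; _∷_)
import Data.Vec as Vec
open import Data.List using (List; _∷_)
open import Data.List.Relation.Unary.Any using (here; there)
open import Data.List.Membership.Propositional using () renaming (_∈_ to _∈ᴸ_)
open import Data.Product using (Σ; _×_; _,_; proj₁; proj₂)
open import Relation.Nullary using (yes; no; contradiction)
open import Relation.Binary.PropositionalEquality using (_≡_; refl; sym; trans; cong; _≢_; subst)

∣h∣≤maxEdgeSize : ∀ {m} {h : Subset m} (hs : List (Subset m)) → h ∈ᴸ hs → ∣ h ∣ ≤ maxEdgeSize hs
∣h∣≤maxEdgeSize (h ∷ hs) (here refl) = m≤m⊔n ∣ h ∣ (maxEdgeSize hs)
∣h∣≤maxEdgeSize (h ∷ hs) (there h∈) = ≤-trans (∣h∣≤maxEdgeSize hs h∈) (m≤n⊔m ∣ h ∣ (maxEdgeSize hs))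

∣p∣≤∣p─q∣+∣q∣ : ∀ {m} (p q : Subset m) → ∣ p ∣ ≤ ∣ p ─ q ∣ + ∣ q ∣
∣p∣≤∣p─q∣+∣q∣ []            []            = z≤n
∣p∣≤∣p─q∣+∣q∣ (outside ∷ p) (outside ∷ q) = ∣p∣≤∣p─q∣+∣q∣ p q
∣p∣≤∣p─q∣+∣q∣ (inside  ∷ p) (outside ∷ q) = s≤s (∣p∣≤∣p─q∣+∣q∣ p q)
∣p∣≤∣p─q∣+∣q∣ (outside ∷ p) (inside  ∷ q) =
  subst (∣ p ∣ ≤_) (sym (+-suc ∣ p ─ q ∣ ∣ q ∣)) (m≤n⇒m≤1+n (∣p∣≤∣p─q∣+∣q∣ p q))
∣p∣≤∣p─q∣+∣q∣ (inside  ∷ p) (inside  ∷ q) =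
  subst (suc ∣ p ∣ ≤_) (sym (+-suc ∣ p ─ q ∣ ∣ q ∣)) (s≤s (∣p∣≤∣p─q∣+∣q∣ p q))

x∈p─q⇒x∉q : ∀ {m} {x : Fin m} (p q : Subset m) → x ∈ p ─ q → x ∉ q
x∈p─q⇒x∉q (inside ∷ p) (outside ∷ q) Vec.here ()
x∈p─q⇒x∉q (_ ∷ p) (_ ∷ q) (Vec.there x∈) (Vec.there x∈q) = x∈p─q⇒x∉q p q x∈ x∈q

⌈m/d⌉≤t : ∀ {m t} d .{{_ : NonZero d}} → m ≤ t * d → ⌈ m / d ⌉ ≤ t
⌈m/d⌉≤t {m} {t} (suc d) m≤td = ≤-pred (m<n*o⇒m/o<n m+d<[1+t]*[1+d])
  where
  m+d<[1+t]*[1+d] : m + suc d ∸ 1 < suc t * suc d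
  m+d<[1+t]*[1+d] rewrite +-suc m d =
    s≤s (subst (_≤ d + t * suc d) (+-comm d m) (+-monoʳ-≤ d m≤td))

module _ {H : Hypergraph} where

  Burned-mono : ∀ {B B′ t v} → B ⊆ B′ → Burned H B t v → Burned H B′ t v
  Burned-mono B⊆B′ (initial v∈B)         = initial (B⊆B′ v∈B)
  Burned-mono B⊆B′ (stay b)              = stay (Burned-mono B⊆B′ b)
  Burned-mono B⊆B′ (spread h h∈ v∈h hb) =
    spread h h∈ v∈h λ u u∈h u≢v → Burned-mono B⊆B′ (hb u u∈h u≢v)

  ∈⇒Burned : ∀ {B v} → v ∈ B → ∀ t → Burned H B t v
  ∈⇒Burned v∈B zero    = initial v∈B
  ∈⇒Burned v∈B (suc t) = stay (∈⇒Burned v∈B t)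

module Greedy (H : Hypergraph) (noIsolated : NoIsolated H) where

  private
    N = n H
    Δ = maxEdgeSize (edges H)

  edgeOf : Fin N → Subset N
  edgeOf v = proj₁ (noIsolated v)

  edgeOf-∈ᴸ : ∀ v → edgeOf v ∈ᴸ edges H
  edgeOf-∈ᴸ v = proj₁ (proj₂ (noIsolated v))

  ∈edgeOf : ∀ v → v ∈ edgeOf v
  ∈edgeOf v = proj₂ (proj₂ (noIsolated v))

  -- State after k picks: B is the current burning set, R the set of vertices
  -- not yet covered by a picked hyperedge.  Vertices outside R already burn
  -- from B ─ R, which is contained in every later burning set.
  record Invariant (B R : Subset N) (k : ℕ) : Set where
    field
      R⊆B      : R ⊆ B
      ∣B∣+k≤N  : ∣ B ∣ + k ≤ N
      N≤∣R∣+kΔ : N ≤ ∣ R ∣ + k * Δ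
      covered  : ∀ w → w ∉ R → Burned H (B ─ R) k w

  invariant-start : Invariant ⊤ ⊤ 0
  invariant-start = record
    { R⊆B      = λ w∈⊤ → w∈⊤
    ; ∣B∣+k≤N  = ≤-reflexive ∣⊤∣+0≡N
    ; N≤∣R∣+kΔ = ≤-reflexive (sym ∣⊤∣+0≡N)
    ; covered  = λ w w∉⊤ → contradiction ∈⊤ w∉⊤
    }
    where
    ∣⊤∣+0≡N : ∣ ⊤ {N} ∣ + 0 ≡ N
    ∣⊤∣+0≡N = trans (+-identityʳ ∣ ⊤ {N} ∣) (∣⊤∣≡n N)

  invariant-step : ∀ {B R k v} → v ∈ R → Invariant B R k →
                   Invariant (B - v) (R ─ edgeOf v) (suc k)
  invariant-step {B} {R} {k} {v} v∈R inv = record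
    { R⊆B      = λ w∈R₁ → x∈p∧x≢y⇒x∈p-y (R⊆B (p─q⊆p R h w∈R₁)) (λ { refl → x∈p─q⇒x∉q R h w∈R₁ v∈h })
    ; ∣B∣+k≤N  = ≤-trans (≤-reflexive (+-suc ∣ B - v ∣ k))
                         (≤-trans (+-monoˡ-≤ k (x∈p⇒∣p-x∣<∣p∣ (R⊆B v∈R))) ∣B∣+k≤N)
    ; N≤∣R∣+kΔ = ≤-trans N≤∣R∣+kΔ
                   (≤-trans (+-monoˡ-≤ (k * Δ) ∣R∣≤∣R₁∣+Δ) (≤-reflexive (+-assoc ∣ R ─ h ∣ Δ (k * Δ))))
    ; covered  = covered₁
    }
    where
    open Invariant inv
    h = edgeOf v
    v∈h = ∈edgeOf v
    R₁ = R ─ h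

    ∣R∣≤∣R₁∣+Δ : ∣ R ∣ ≤ ∣ R₁ ∣ + Δ
    ∣R∣≤∣R₁∣+Δ = ≤-trans (∣p∣≤∣p─q∣+∣q∣ R h) (+-monoʳ-≤ ∣ R₁ ∣ (∣h∣≤maxEdgeSize (edges H) (edgeOf-∈ᴸ v)))

    B─R⊆B₁─R₁ : B ─ R ⊆ (B - v) ─ R₁
    B─R⊆B₁─R₁ w∈B─R = x∈p∧x∉q⇒x∈p─q
      (x∈p∧x≢y⇒x∈p-y (p─q⊆p B R w∈B─R) (λ { refl → w∉R v∈R }))
      (λ w∈R₁ → w∉R (p─q⊆p R h w∈R₁))
      where w∉R = x∈p─q⇒x∉q B R w∈B─R

    uncovered≢v⇒∈B₁─R₁ : ∀ {w} → w ∈ R → w ≢ v → w ∉ R₁ → w ∈ (B - v) ─ R₁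
    uncovered≢v⇒∈B₁─R₁ w∈R w≢v w∉R₁ = x∈p∧x∉q⇒x∈p─q (x∈p∧x≢y⇒x∈p-y (R⊆B w∈R) w≢v) w∉R₁

    -- v itself burns in round k + 1 through h: every other vertex of h was
    -- either covered earlier or is still in the burning set.
    covered₁ : ∀ w → w ∉ R₁ → Burned H ((B - v) ─ R₁) (suc k) w
    covered₁ w w∉R₁ with w ∈? R | w ≟ᶠ v
    ... | no w∉R  | _        = stay (Burned-mono B─R⊆B₁─R₁ (covered w w∉R))
    ... | yes w∈R | no w≢v   = ∈⇒Burned (uncovered≢v⇒∈B₁─R₁ w∈R w≢v w∉R₁) (suc k)
    ... | yes _   | yes refl = spread h (edgeOf-∈ᴸ v) v∈h neighbour
      where
      neighbour : ∀ u → u ∈ h → u ≢ v → Burned H ((B - v) ─ R₁) k u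
      neighbour u u∈h u≢v with u ∈? R
      ... | no u∉R  = Burned-mono B─R⊆B₁─R₁ (covered u u∉R)
      ... | yes u∈R = ∈⇒Burned (uncovered≢v⇒∈B₁─R₁ u∈R u≢v (λ u∈R₁ → x∈p─q⇒x∉q R h u∈R₁ u∈h)) k

  Outcome : Set
  Outcome = Σ (Subset N) λ B → Σ ℕ λ t → (∀ v → Burned H B t v) × (∣ B ∣ + t ≤ N) × (N ≤ t * Δ)

  invariant-finish : ∀ {B R k} → Empty R → Invariant B R k → Outcome
  invariant-finish {B} {R} {k} R-empty inv =
    B , k , (λ w → Burned-mono (p─q⊆p B R) (covered w (λ w∈R → R-empty (w , w∈R)))) , ∣B∣+k≤N ,
    subst (λ r → N ≤ r + k * Δ) ∣R∣≡0 N≤∣R∣+kΔ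
    where
    open Invariant inv
    ∣R∣≡0 : ∣ R ∣ ≡ 0
    ∣R∣≡0 = trans (cong ∣_∣ (Empty-unique R-empty)) (∣⊥∣≡0 N)

  greedy : ∀ fuel {B R k} → ∣ R ∣ ≤ fuel → Invariant B R k → Outcome
  greedy fuel {R = R} ∣R∣≤fuel inv with nonempty? R
  ... | no R-empty = invariant-finish R-empty inv
  greedy zero ∣R∣≤0 inv | yes (v , v∈R) = contradiction (≤-trans (x∈p⇒∣p-x∣<∣p∣ v∈R) ∣R∣≤0) λ ()
  greedy (suc fuel) {R = R} ∣R∣≤1+fuel inv | yes (v , v∈R) =
    greedy fuel (≤-pred (≤-trans (p∩q≢∅⇒∣p─q∣<∣p∣ R (edgeOf v) (v , x∈p∩q⁺ (v∈R , ∈edgeOf v))) ∣R∣≤1+fuel))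
      (invariant-step v∈R inv)

  greedyBurningSet : Outcome
  greedyBurningSet = greedy N (≤-reflexive (∣⊤∣≡n N)) invariant-start

theorem2p16 : (H : Hypergraph) → NoIsolated H → .{{_ : NonZero (maxEdgeSize (edges H))}} →
    Σ (Subset (n H)) λ B → IsLazyBurningSet H B × (∣ B ∣ ≤ n H ∸ ⌈ n H / maxEdgeSize (edges H) ⌉)
theorem2p16 H noIsolated with Greedy.greedyBurningSet H noIsolated
... | B , t , burns , ∣B∣+t≤N , N≤tΔ =
  B , (t , burns) , ≤-trans (m+n≤o⇒m≤o∸n ∣ B ∣ ∣B∣+t≤N) (∸-monoʳ-≤ (n H) (⌈m/d⌉≤t {t = t} _ N≤tΔ))
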